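{- Let $m \ge 1$ and $k \ge 2$ be integers, and let $\alpha = \alpha(m) = \sqrt{2^m/(2^m-1)}$. Then $S_m(k) > \alpha^k$.
   Context: For positive integers $m$ and $k$, a $k$-term semi-progression of scope $m$ is a sequence of integers $(x_1,x_2,\ldots,x_k)$ such that for some positive integer $d$ (the low-difference), $x_{j+1}-x_j \in \{d,2d,\ldots,md\}$ for every $1 \le j \le k-1$. (Thus an arithmetic progression is a semi-progression of scope $1$.) $S_m(k)$ denotes the least positive integer $N$ such that every $2$-coloring of $\{1,2,\ldots,N\}$ contains a monochromatic $k$-term semi-progression of scope $m$. -}

module Defs where

open import Data.Nat using (ℕ; zero; suc; _+_; _*_; _≤_; _<_)
open import Data.Bool using (Bool)
open import Data.Product using (Σ; ∃; _×_)
open import Relation.Binary.PropositionalEquality using (_≡_)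

IsSemiProg : (m k : ℕ) → (ℕ → ℕ) → Set
IsSemiProg m k x =
  Σ ℕ λ d → 1 ≤ d × (∀ (j : ℕ) → suc j < k →
    Σ ℕ λ t → 1 ≤ t × t ≤ m × x (suc j) ≡ x j + t * d)

InRange : (k N : ℕ) → (ℕ → ℕ) → Set
InRange k N x = ∀ (j : ℕ) → j < k → 1 ≤ x j × x j ≤ N

Monochromatic : (k : ℕ) → (ℕ → Bool) → Bool → (ℕ → ℕ) → Set
Monochromatic k χ c x = ∀ (j : ℕ) → j < k → χ (x j) ≡ c

-- Every 2-colouring of {1, …, N} (a colouring ℕ → Bool, of which only the
-- values on {1, …, N} matter) contains a monochromatic k-term
-- semi-progression of scope m.  S_m(k) is the least N with this property.
Forces : (m k N : ℕ) → Set
Forces m k N = ∀ (χ : ℕ → Bool) →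
  Σ (ℕ → ℕ) λ x → Σ Bool λ c →
    IsSemiProg m k x × InRange k N x × Monochromatic k χ c x

-- First-moment argument.  For a start a and low-difference d, a monochromatic semi-progression
-- exists only if the greedy search along a, a + d, a + 2d, … succeeds: k − 1 times, jump to the
-- first point with the colour of a among the next m.  Each jump inspects fresh points, so it
-- fails with probability at least 2⁻ᵐ independently of the others, and a uniformly random
-- colouring of {1, …, N} is bad for (a, d) with probability at most (1 − 2⁻ᵐ)^(k−1).  A union
-- bound over the N(N − 1)/2 pairs leaves a good colouring unless
-- N(N − 1)/2 · (2ᵐ − 1)^(k−1) ≥ 2^(m(k−1)), and multiplying by 2ᵐ ≤ 2(2ᵐ − 1) gives
-- 2^(mk) < N² (2ᵐ − 1)ᵏ.  Probabilities appear as counts of colourings, cleared of denominators.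

module Submission where

open import Defs
open import Data.Nat using (ℕ; _*_; _^_; _∸_; _≤_; _<_)
open import Data.Nat using (zero; suc; _+_; _≟_; _≤?_; _<?_; _≰_; z≤n; s≤s; s≤s⁻¹; >-nonZero)
open import Data.Nat.Properties
open import Data.Nat.Tactic.RingSolver using (solve-∀)
open import Algebra.Properties.CommutativeSemigroup +-commutativeSemigroup using (interchange)
open import Algebra.Properties.CommutativeSemigroup *-commutativeSemigroup using () renaming (x∙yz≈y∙xz to *-left-comm)
open import Data.Bool using (Bool; true; false; not)
import Data.Bool as B
open import Data.Bool.Properties using (not-¬)
open import Data.List using (List; []; _∷_; length; applyDownFrom)
open import Data.List.Properties using (length-removeAt′; length-applyDownFrom)
open import Data.List.Membership.Propositional using (_∈_; _∉_)
open import Data.List.Membership.Propositional.Properties using (∈-applyDownFrom⁺)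
open import Data.List.Relation.Unary.Any using (here; there; index; _─_)
open import Data.List.Relation.Unary.All as All using (All; _∷_)
open import Data.List.Relation.Unary.AllPairs using (_∷_)
open import Data.List.Relation.Unary.Unique.Propositional using (Unique)
open import Data.List.Relation.Unary.Unique.Propositional.Properties using (applyDownFrom⁺₁)
open import Data.Product using (Σ; _,_; _×_; proj₁; proj₂)
open import Data.Empty using (⊥-elim)
open import Data.Sum using (inj₁; inj₂)
open import Function using (_∘_)
open import Relation.Nullary using (Dec; yes; no)
open import Relation.Binary.PropositionalEquality

module _ {A : Set} where

  ∈-─⁺ : ∀ {S : List A} {q n} (q∈S : q ∈ S) → n ∈ S → n ≢ q → n ∈ (S ─ q∈S)
  ∈-─⁺ (here refl) (here refl) n≢q = ⊥-elim (n≢q refl)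
  ∈-─⁺ (here refl) (there n∈) n≢q = n∈
  ∈-─⁺ (there q∈) (here refl) n≢q = here refl
  ∈-─⁺ (there q∈) (there n∈) n≢q = there (∈-─⁺ q∈ n∈ n≢q)

  All-─ : ∀ {P : A → Set} {S : List A} {q} (q∈S : q ∈ S) → All P S → All P (S ─ q∈S)
  All-─ (here refl) (_ ∷ ps) = ps
  All-─ (there q∈) (p ∷ ps) = p ∷ All-─ q∈ ps

  Unique-─ : ∀ {S : List A} {q} (q∈S : q ∈ S) → Unique S → Unique (S ─ q∈S)
  Unique-─ (here refl) (_ ∷ u) = u
  Unique-─ (there q∈) (s≢ ∷ u) = All-─ q∈ s≢ ∷ Unique-─ q∈ u

  ∉-─ : ∀ {S : List A} {q} (q∈S : q ∈ S) → Unique S → q ∉ (S ─ q∈S)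
  ∉-─ (here refl) (q≢ ∷ _) q∈ = All.lookup q≢ q∈ refl
  ∉-─ (there q∈) (s≢ ∷ u) (here refl) = All.lookup s≢ q∈ refl
  ∉-─ (there q∈) (_ ∷ u) (there q∈′) = ∉-─ q∈ u q∈′

  length-─ : ∀ {S : List A} {q} (q∈S : q ∈ S) → length S ≡ suc (length (S ─ q∈S))
  length-─ {S} q∈S = length-removeAt′ S (index q∈S)

Colouring : Set
Colouring = ℕ → Bool

_[_≔_] : Colouring → ℕ → Bool → Colouring
(χ [ q ≔ b ]) n with n ≟ q
... | yes _ = b
... | no  _ = χ n

[≔]-≡ : ∀ χ q b → (χ [ q ≔ b ]) q ≡ b
[≔]-≡ χ q b with q ≟ q
... | yes _  = refl
... | no q≢q = ⊥-elim (q≢q refl)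

[≔]-≢ : ∀ χ {q n} b → n ≢ q → (χ [ q ≔ b ]) n ≡ χ n
[≔]-≢ χ {q} {n} b n≢q with n ≟ q
... | yes n≡q = ⊥-elim (n≢q n≡q)
... | no  _   = refl

[≔]-cong : ∀ {χ χ′} q b → χ ≗ χ′ → χ [ q ≔ b ] ≗ χ′ [ q ≔ b ]
[≔]-cong q b χ≗χ′ n with n ≟ q
... | yes _ = refl
... | no  _ = χ≗χ′ n

[≔]-comm : ∀ χ {q r} b c → q ≢ r → χ [ r ≔ c ] [ q ≔ b ] ≗ χ [ q ≔ b ] [ r ≔ c ]
[≔]-comm χ {q} {r} b c q≢r n with n ≟ q | n ≟ r
... | yes refl | yes refl = ⊥-elim (q≢r refl)
... | yes refl | no n≢r   = sym ([≔]-≡ χ n b)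
... | no n≢q   | yes refl = [≔]-≡ χ n c
... | no n≢q   | no n≢r   = trans ([≔]-≢ χ c n≢r) (sym ([≔]-≢ χ b n≢q))

Extensional : {A : Set} → (Colouring → A) → Set
Extensional F = ∀ {ψ ψ′} → ψ ≗ ψ′ → F ψ ≡ F ψ′

AgreeOff : List ℕ → Colouring → Colouring → Set
AgreeOff S χ ψ = ∀ n → n ∉ S → ψ n ≡ χ n

-- Sum of F over the colourings that agree with χ off S (each counted once when S is Unique).
count : List ℕ → (Colouring → ℕ) → Colouring → ℕ
count []      F χ = F χ
count (q ∷ S) F χ = count S F (χ [ q ≔ false ]) + count S F (χ [ q ≔ true ])

AgreeOff-≔ : ∀ {S q χ ψ} b → q ∉ S → AgreeOff S (χ [ q ≔ b ]) ψ → ψ q ≡ b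
AgreeOff-≔ {q = q} {χ} b q∉S ψ~ = trans (ψ~ q q∉S) ([≔]-≡ χ q b)

count-resp : ∀ S {F} → Extensional F → ∀ {χ χ′} → χ ≗ χ′ → count S F χ ≡ count S F χ′
count-resp []      ext χ≗χ′ = ext χ≗χ′
count-resp (q ∷ S) ext χ≗χ′ =
  cong₂ _+_ (count-resp S ext ([≔]-cong q false χ≗χ′)) (count-resp S ext ([≔]-cong q true χ≗χ′))

count-cong : ∀ S {F G} χ → (∀ ψ → AgreeOff S χ ψ → F ψ ≡ G ψ) → count S F χ ≡ count S G χ
count-cong []      χ F≡G = F≡G χ (λ _ _ → refl)
count-cong (q ∷ S) χ F≡G = cong₂ _+_ (count-cong S _ (agree false)) (count-cong S _ (agree true))
  where
  agree : ∀ b ψ → AgreeOff S (χ [ q ≔ b ]) ψ → _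
  agree b ψ ψ~ = F≡G ψ λ n n∉ → trans (ψ~ n (λ n∈ → n∉ (there n∈))) ([≔]-≢ χ b (λ n≡q → n∉ (here n≡q)))

count-const : ∀ S k χ → count S (λ _ → k) χ ≡ 2 ^ length S * k
count-const []      k χ = sym (+-identityʳ k)
count-const (q ∷ S) k χ = begin
  count S _ (χ [ q ≔ false ]) + count S _ (χ [ q ≔ true ])
    ≡⟨ cong₂ _+_ (count-const S k _) (count-const S k _) ⟩
  2 ^ length S * k + 2 ^ length S * k
    ≡⟨ cong (2 ^ length S * k +_) (sym (+-identityʳ _)) ⟩
  2 * (2 ^ length S * k)
    ≡⟨ *-assoc 2 (2 ^ length S) k ⟨
  2 ^ length (q ∷ S) * k ∎
  where open ≡-Reasoning

count-0 : ∀ S χ → count S (λ _ → 0) χ ≡ 0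
count-0 S χ = trans (count-const S 0 χ) (*-zeroʳ (2 ^ length S))

count-+ : ∀ S F G χ → count S (λ ψ → F ψ + G ψ) χ ≡ count S F χ + count S G χ
count-+ []      F G χ = refl
count-+ (q ∷ S) F G χ =
  trans (cong₂ _+_ (count-+ S F G _) (count-+ S F G _))
        (interchange (count S F χ₀) (count S G χ₀) (count S F χ₁) (count S G χ₁))
  where
  χ₀ = χ [ q ≔ false ]
  χ₁ = χ [ q ≔ true ]

count<⇒zero : ∀ S F χ → count S F χ < 2 ^ length S → Σ Colouring λ ψ → F ψ ≡ 0
count<⇒zero []      F χ F<1 = χ , n<1⇒n≡0 F<1
count<⇒zero (q ∷ S) F χ F< with count S F (χ [ q ≔ false ]) <? 2 ^ length S
... | yes F₀< = count<⇒zero S F _ F₀<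
... | no  F₀≮ = count<⇒zero S F _ (+-cancelˡ-< P _ _ (begin-strict
      P + count S F (χ [ q ≔ true ]) ≤⟨ +-monoˡ-≤ _ (≮⇒≥ F₀≮) ⟩
      count S F (χ [ q ≔ false ]) + count S F (χ [ q ≔ true ]) <⟨ F< ⟩
      2 * P ≡⟨ cong (P +_) (+-identityʳ P) ⟩
      P + P ∎))
  where
  P = 2 ^ length S
  open ≤-Reasoning

count-pull : ∀ {S q} F (q∈S : q ∈ S) → Unique S → Extensional F → ∀ χ →
  count S F χ ≡ count (S ─ q∈S) F (χ [ q ≔ false ]) + count (S ─ q∈S) F (χ [ q ≔ true ])
count-pull F (here refl) _ _ χ = refl
count-pull {s ∷ T} {q} F (there q∈T) (s≢ ∷ u) ext χ = begin
  count T F (χ [ s ≔ false ]) + count T F (χ [ s ≔ true ])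
    ≡⟨ cong₂ _+_ (count-pull F q∈T u ext _) (count-pull F q∈T u ext _) ⟩
  (C false false + C false true) + (C true false + C true true)
    ≡⟨ interchange (C false false) (C false true) (C true false) (C true true) ⟩
  (C false false + C true false) + (C false true + C true true)
    ≡⟨ cong₂ _+_ (cong₂ _+_ (swap false false) (swap true false))
                 (cong₂ _+_ (swap false true) (swap true true)) ⟩
  count (s ∷ T′) F (χ [ q ≔ false ]) + count (s ∷ T′) F (χ [ q ≔ true ]) ∎
  where
  open ≡-Reasoning
  T′ = T ─ q∈T
  C : Bool → Bool → ℕ
  C b c = count T′ F (χ [ s ≔ b ] [ q ≔ c ])
  swap : ∀ b c → C b c ≡ count T′ F (χ [ q ≔ c ] [ s ≔ b ])
  swap b c = count-resp T′ ext ([≔]-comm χ c b (λ q≡s → All.lookup s≢ q∈T (sym q≡s)))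

𝟙 : Bool → ℕ
𝟙 true  = 1
𝟙 false = 0

-- Y / P ≤ (1 - 1/Q) · A / D, cleared of denominators and subtraction.
FractionBound : (Y P Q D A : ℕ) → Set
FractionBound Y P Q D A = Y * Q * D + P * A ≤ P * Q * A

FractionBound-0 : ∀ P Q D A → 1 ≤ Q → FractionBound 0 P Q D A
FractionBound-0 P Q D A Q≥1 = begin
  P * A     ≡⟨ cong (_* A) (*-identityʳ P) ⟨
  P * 1 * A ≤⟨ *-monoˡ-≤ A (*-monoʳ-≤ P Q≥1) ⟩
  P * Q * A ∎
  where open ≤-Reasoning

-- 1 - 1/(2Q) is the average of 1 and 1 - 1/Q.
FractionBound-average : ∀ Y Y′ P Q D A → Y * D ≤ P * A → FractionBound Y′ P Q D A →
  FractionBound (Y + Y′) (2 * P) (2 * Q) D A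
FractionBound-average Y Y′ P Q D A Y-bound Y′-bound = begin
  (Y + Y′) * (2 * Q) * D + 2 * P * A           ≡⟨ regroup Y Y′ Q D P A ⟩
  2 * (Q * (Y * D)) + 2 * (Y′ * Q * D + P * A) ≤⟨ +-mono-≤ (*-monoʳ-≤ 2 (*-monoʳ-≤ Q Y-bound))
                                                            (*-monoʳ-≤ 2 Y′-bound) ⟩
  2 * (Q * (P * A)) + 2 * (P * Q * A)          ≡⟨ collect Q P A ⟩
  2 * P * (2 * Q) * A                          ∎
  where
  open ≤-Reasoning
  regroup : ∀ Y Y′ Q D P A → (Y + Y′) * (2 * Q) * D + 2 * P * A ≡ 2 * (Q * (Y * D)) + 2 * (Y′ * Q * D + P * A)
  regroup = solve-∀
  collect : ∀ Q P A → 2 * (Q * (P * A)) + 2 * (P * Q * A) ≡ 2 * P * (2 * Q) * A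
  collect = solve-∀

FractionBound⇒≤ : ∀ Y P Q e D A → Q ≡ suc e → FractionBound Y P Q D A → Y * (Q * D) ≤ P * (e * A)
FractionBound⇒≤ Y P Q e D A refl bound = +-cancelʳ-≤ (P * A) _ _ (begin
  Y * (suc e * D) + P * A ≡⟨ cong (_+ P * A) (*-assoc Y (suc e) D) ⟨
  Y * suc e * D + P * A   ≤⟨ bound ⟩
  P * suc e * A           ≡⟨ expand P e A ⟩
  P * (e * A) + P * A     ∎)
  where
  open ≤-Reasoning
  expand : ∀ P e A → P * suc e * A ≡ P * (e * A) + P * A
  expand = solve-∀

module Greedy (m N d : ℕ) where

  scan : (ℕ → Colouring → Bool) → Bool → ℕ → ℕ → Colouring → Bool
  scan g c zero    q ψ = false
  scan g c (suc f) q ψ with q + d ≤? N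
  ... | no  _ = false
  ... | yes _ with ψ (q + d) B.≟ c
  ...   | yes _ = g (q + d) ψ
  ...   | no  _ = scan g c f (q + d) ψ

  greedy : Bool → ℕ → ℕ → Colouring → Bool
  greedy c zero    p ψ = true
  greedy c (suc j) p ψ = scan (greedy c j) c m p ψ

  monochromaticFrom : ℕ → ℕ → Colouring → Bool
  monochromaticFrom j a ψ = greedy (ψ a) j a ψ

  scan-stop : ∀ g c f q ψ → q + d ≰ N → scan g c (suc f) q ψ ≡ false
  scan-stop g c f q ψ q+d≰N with q + d ≤? N
  ... | yes q+d≤N = ⊥-elim (q+d≰N q+d≤N)
  ... | no  _     = refl

  scan-hit : ∀ g c f q ψ → q + d ≤ N → ψ (q + d) ≡ c → scan g c (suc f) q ψ ≡ g (q + d) ψ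
  scan-hit g c f q ψ q+d≤N hit with q + d ≤? N
  ... | no q+d≰N = ⊥-elim (q+d≰N q+d≤N)
  ... | yes _ with ψ (q + d) B.≟ c
  ...   | yes _    = refl
  ...   | no  miss = ⊥-elim (miss hit)

  scan-miss : ∀ g c f q ψ → q + d ≤ N → ψ (q + d) ≢ c → scan g c (suc f) q ψ ≡ scan g c f (q + d) ψ
  scan-miss g c f q ψ q+d≤N miss with q + d ≤? N
  ... | no q+d≰N = ⊥-elim (q+d≰N q+d≤N)
  ... | yes _ with ψ (q + d) B.≟ c
  ...   | yes hit = ⊥-elim (miss hit)
  ...   | no  _   = refl

  scan-resp : ∀ g c → (∀ q → Extensional (g q)) → ∀ f q → Extensional (scan g c f q)
  scan-resp g c g-resp zero    q ψ≗ψ′ = refl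
  scan-resp g c g-resp (suc f) q {ψ} {ψ′} ψ≗ψ′ with q + d ≤? N
  ... | no  _ = refl
  ... | yes _ with ψ (q + d) B.≟ c | ψ′ (q + d) B.≟ c
  ...   | yes _   | yes _    = g-resp (q + d) ψ≗ψ′
  ...   | no  _   | no  _    = scan-resp g c g-resp f (q + d) ψ≗ψ′
  ...   | yes hit | no  miss = ⊥-elim (miss (trans (sym (ψ≗ψ′ (q + d))) hit))
  ...   | no  miss | yes hit = ⊥-elim (miss (trans (ψ≗ψ′ (q + d)) hit))

  greedy-resp : ∀ c j p → Extensional (greedy c j p)
  greedy-resp c zero    p ψ≗ψ′ = refl
  greedy-resp c (suc j) p      = scan-resp (greedy c j) c (greedy-resp c j) m p

  monochromaticFrom-resp : ∀ j a → Extensional (monochromaticFrom j a)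
  monochromaticFrom-resp j a {ψ} {ψ′} ψ≗ψ′ rewrite ψ≗ψ′ a = greedy-resp (ψ′ a) j a ψ≗ψ′

  Step : Bool → Colouring → ℕ → ℕ → Set
  Step c ψ u v = Σ ℕ λ t → 1 ≤ t × t ≤ m × v ≡ u + t * d × v ≤ N × ψ v ≡ c

  Chain : Bool → ℕ → ℕ → Colouring → Set
  Chain c j p ψ = Σ (ℕ → ℕ) λ y → y 0 ≡ p × (∀ i → i < j → Step c ψ (y i) (y (suc i)))

  +1*d : ∀ q → q + 1 * d ≡ q + d
  +1*d q = cong (q +_) (*-identityˡ d)

  +d+*d : ∀ q t → q + d + t * d ≡ q + suc t * d
  +d+*d q t = +-assoc q d (t * d)

  scan-complete : ∀ g c f q ψ t → 1 ≤ t → t ≤ f → q + t * d ≤ N → ψ (q + t * d) ≡ c →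
    (∀ s → 1 ≤ s → s ≤ t → ψ (q + s * d) ≡ c → g (q + s * d) ψ ≡ true) →
    scan g c f q ψ ≡ true
  scan-complete g c (suc f) q ψ (suc t) _ (s≤s t≤f) inN col accept with ψ (q + d) B.≟ c
  ... | yes hit = trans (scan-hit g c f q ψ q+d≤N hit)
                        (subst (λ x → g x ψ ≡ true) (+1*d q)
                               (accept 1 ≤-refl (s≤s z≤n) (subst (λ x → ψ x ≡ c) (sym (+1*d q)) hit)))
    where q+d≤N = ≤-trans (+-monoʳ-≤ q (m≤m+n d (t * d))) inN
  ... | no miss = trans (scan-miss g c f q ψ q+d≤N miss) (continue t refl)
    where
    q+d≤N = ≤-trans (+-monoʳ-≤ q (m≤m+n d (t * d))) inN
    continue : ∀ t′ → t′ ≡ t → scan g c f (q + d) ψ ≡ true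
    continue zero    refl = ⊥-elim (miss (subst (λ x → ψ x ≡ c) (+1*d q) col))
    continue (suc t′) refl =
      scan-complete g c f (q + d) ψ (suc t′) (s≤s z≤n) t≤f
        (subst (_≤ N) (sym (+d+*d q (suc t′))) inN)
        (subst (λ x → ψ x ≡ c) (sym (+d+*d q (suc t′))) col)
        λ s s≥1 s≤t col′ → subst (λ x → g x ψ ≡ true) (sym (+d+*d q s))
          (accept (suc s) (s≤s z≤n) (s≤s s≤t) (subst (λ x → ψ x ≡ c) (+d+*d q s) col′))

  -- Greedy is optimal: from any earlier point p + s d of colour c, the original next term p + t d is still within m steps.
  greedy-complete : ∀ c j p ψ → Chain c j p ψ → greedy c j p ψ ≡ true
  greedy-complete c zero    p ψ _ = refl
  greedy-complete c (suc j) p ψ (y , y₀≡p , steps) with steps 0 (s≤s z≤n)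
  ... | t , t≥1 , t≤m , y₁≡ , y₁≤N , y₁-col =
    scan-complete (greedy c j) c m p ψ t t≥1 t≤m (subst (_≤ N) y₁≡p+td y₁≤N)
                  (subst (λ x → ψ x ≡ c) y₁≡p+td y₁-col) restart
    where
    y₁≡p+td : y 1 ≡ p + t * d
    y₁≡p+td = trans y₁≡ (cong (_+ t * d) y₀≡p)
    restart : ∀ s → 1 ≤ s → s ≤ t → ψ (p + s * d) ≡ c → greedy c j (p + s * d) ψ ≡ true
    restart s _ s≤t col with m≤n⇒m<n∨m≡n s≤t
    ... | inj₂ refl = greedy-complete c j _ ψ (y ∘ suc , y₁≡p+td , λ i i<j → steps (suc i) (s≤s i<j))
    ... | inj₁ s<t  = greedy-complete c j _ ψ (y′ , refl , steps′)
      where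
      y′ : ℕ → ℕ
      y′ zero    = p + s * d
      y′ (suc i) = y (suc i)
      jump : y 1 ≡ p + s * d + (t ∸ s) * d
      jump = begin
        y 1                       ≡⟨ y₁≡p+td ⟩
        p + t * d                 ≡⟨ cong (λ x → p + x * d) (m+[n∸m]≡n s≤t) ⟨
        p + (s + (t ∸ s)) * d     ≡⟨ cong (p +_) (*-distribʳ-+ d s (t ∸ s)) ⟩
        p + (s * d + (t ∸ s) * d) ≡⟨ +-assoc p (s * d) ((t ∸ s) * d) ⟨
        p + s * d + (t ∸ s) * d   ∎
        where open ≡-Reasoning
      steps′ : ∀ i → i < j → Step c ψ (y′ i) (y′ (suc i))
      steps′ zero    _   = t ∸ s , m<n⇒0<n∸m s<t , ≤-trans (m∸n≤m t s) t≤m , jump , y₁≤N , y₁-col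
      steps′ (suc i) i<j = steps (suc i) (m<n⇒m<1+n i<j)

  module Counting (d≥1 : 1 ≤ d) where

    FreeBeyond : ℕ → List ℕ → Set
    FreeBeyond p S = ∀ t → 1 ≤ t → p + t * d ≤ N → p + t * d ∈ S

    beyond-≢ : ∀ p t → 1 ≤ t → p + t * d ≢ p
    beyond-≢ p t t≥1 = >⇒≢ (m<m+n p (*-mono-≤ t≥1 d≥1))

    next-free : ∀ {q S} → FreeBeyond q S → q + d ≤ N → q + d ∈ S
    next-free {q} {S} free q+d≤N =
      subst (_∈ S) (+1*d q) (free 1 ≤-refl (subst (_≤ N) (sym (+1*d q)) q+d≤N))

    FreeBeyond-next : ∀ {q S} → FreeBeyond q S → (q+d∈S : q + d ∈ S) → FreeBeyond (q + d) (S ─ q+d∈S)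
    FreeBeyond-next {q} {S} free q+d∈S t t≥1 inN = ∈-─⁺ q+d∈S
      (subst (_∈ S) (sym (+d+*d q t)) (free (suc t) (s≤s z≤n) (subst (_≤ N) (+d+*d q t) inN)))
      (beyond-≢ (q + d) t t≥1)

    FreeBeyond-here : ∀ {a S} → FreeBeyond a S → (a∈S : a ∈ S) → FreeBeyond a (S ─ a∈S)
    FreeBeyond-here {a} free a∈S t t≥1 inN = ∈-─⁺ a∈S (free t t≥1 inN) (beyond-≢ a t t≥1)

    module _ (g : ℕ → Colouring → Bool) (c : Bool) (g-resp : ∀ q → Extensional (g q)) (D A : ℕ)
             (g-count : ∀ q S χ → Unique S → FreeBeyond q S →
                          count S (𝟙 ∘ g q) χ * D ≤ 2 ^ length S * A) where

      scan-count : ∀ f q S χ → Unique S → FreeBeyond q S →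
        FractionBound (count S (𝟙 ∘ scan g c f q) χ) (2 ^ length S) (2 ^ f) D A
      scan-count zero    q S χ u free =
        subst (λ Y → FractionBound Y (2 ^ length S) 1 D A) (sym (count-0 S χ))
              (FractionBound-0 (2 ^ length S) 1 D A ≤-refl)
      scan-count (suc f) q S χ u free = by-range (q + d ≤? N)
        where
        by-range : Dec (q + d ≤ N) →
          FractionBound (count S (𝟙 ∘ scan g c (suc f) q) χ) (2 ^ length S) (2 ^ suc f) D A
        by-range (no q+d≰N) = subst (λ Y → FractionBound Y (2 ^ length S) (2 ^ suc f) D A) (sym count≡0)
                                    (FractionBound-0 (2 ^ length S) (2 ^ suc f) D A (m^n>0 2 (suc f)))
          where
          count≡0 : count S (𝟙 ∘ scan g c (suc f) q) χ ≡ 0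
          count≡0 = trans (count-cong S χ (λ ψ _ → cong 𝟙 (scan-stop g c f q ψ q+d≰N))) (count-0 S χ)
        by-range (yes q+d≤N) = begin
          count S F χ * 2 ^ suc f * D + 2 ^ length S * A
            ≡⟨ cong₂ (λ Y L → Y * 2 ^ suc f * D + 2 ^ L * A) split (length-─ q′∈S) ⟩
          (X c + X (not c)) * 2 ^ suc f * D + 2 * P′ * A
            ≤⟨ FractionBound-average (X c) (X (not c)) P′ (2 ^ f) D A hit-bound miss-bound ⟩
          2 * P′ * 2 ^ suc f * A
            ≡⟨ cong (λ L → 2 ^ L * 2 ^ suc f * A) (length-─ q′∈S) ⟨
          2 ^ length S * 2 ^ suc f * A ∎
          where
          open ≤-Reasoning
          F = 𝟙 ∘ scan g c (suc f) q
          q′ = q + d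
          q′∈S = next-free free q+d≤N
          S′ = S ─ q′∈S
          P′ = 2 ^ length S′
          X : Bool → ℕ
          X b = count S′ F (χ [ q′ ≔ b ])
          split : count S F χ ≡ X c + X (not c)
          split = trans (count-pull F q′∈S u (cong 𝟙 ∘ scan-resp g c g-resp (suc f) q) χ) (both-colours c)
            where
            both-colours : ∀ b → X false + X true ≡ X b + X (not b)
            both-colours false = refl
            both-colours true  = +-comm (X false) (X true)
          hit-bound : X c * D ≤ P′ * A
          hit-bound = subst (λ Y → Y * D ≤ P′ * A)
            (count-cong S′ _ λ ψ ψ~ → cong 𝟙 (sym (scan-hit g c f q ψ q+d≤N (AgreeOff-≔ c (∉-─ q′∈S u) ψ~))))
            (g-count q′ S′ _ (Unique-─ q′∈S u) (FreeBeyond-next free q′∈S))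
          miss-bound : FractionBound (X (not c)) P′ (2 ^ f) D A
          miss-bound = subst (λ Y → FractionBound Y P′ (2 ^ f) D A)
            (count-cong S′ _ λ ψ ψ~ → cong 𝟙 (sym (scan-miss g c f q ψ q+d≤N
               (λ hit → not-¬ hit (AgreeOff-≔ (not c) (∉-─ q′∈S u) ψ~)))))
            (scan-count f q′ S′ _ (Unique-─ q′∈S u) (FreeBeyond-next free q′∈S))

    greedy-count : ∀ e → 2 ^ m ≡ suc e → ∀ c j p S χ → Unique S → FreeBeyond p S →
      count S (𝟙 ∘ greedy c j p) χ * (2 ^ m) ^ j ≤ 2 ^ length S * e ^ j
    greedy-count e 2^m≡1+e c zero    p S χ u free = ≤-reflexive (trans (*-identityʳ _) (count-const S 1 χ))
    greedy-count e 2^m≡1+e c (suc j) p S χ u free =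
      FractionBound⇒≤ (count S (𝟙 ∘ greedy c (suc j) p) χ) (2 ^ length S) (2 ^ m) e ((2 ^ m) ^ j) (e ^ j) 2^m≡1+e
        (scan-count (greedy c j) c (greedy-resp c j) ((2 ^ m) ^ j) (e ^ j) (greedy-count e 2^m≡1+e c j) m p S χ u free)

    monochromaticFrom-count : ∀ e → 2 ^ m ≡ suc e → ∀ j a S χ → Unique S → (a∈S : a ∈ S) → FreeBeyond a S →
      count S (𝟙 ∘ monochromaticFrom j a) χ * (2 ^ m) ^ j ≤ 2 ^ length S * e ^ j
    monochromaticFrom-count e 2^m≡1+e j a S χ u a∈S free = begin
      count S F χ * (2 ^ m) ^ j
        ≡⟨ cong (_* (2 ^ m) ^ j) (count-pull F a∈S u (cong 𝟙 ∘ monochromaticFrom-resp j a) χ) ⟩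
      (X false + X true) * (2 ^ m) ^ j
        ≡⟨ *-distribʳ-+ ((2 ^ m) ^ j) (X false) (X true) ⟩
      X false * (2 ^ m) ^ j + X true * (2 ^ m) ^ j
        ≤⟨ +-mono-≤ (half false) (half true) ⟩
      P′ * e ^ j + P′ * e ^ j
        ≡⟨ cong (P′ * e ^ j +_) (+-identityʳ (P′ * e ^ j)) ⟨
      2 * (P′ * e ^ j)
        ≡⟨ *-assoc 2 P′ (e ^ j) ⟨
      2 * P′ * e ^ j
        ≡⟨ cong (λ L → 2 ^ L * e ^ j) (length-─ a∈S) ⟨
      2 ^ length S * e ^ j ∎
      where
      open ≤-Reasoning
      F = 𝟙 ∘ monochromaticFrom j a
      S′ = S ─ a∈S
      P′ = 2 ^ length S′
      X : Bool → ℕ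
      X b = count S′ F (χ [ a ≔ b ])
      half : ∀ b → X b * (2 ^ m) ^ j ≤ P′ * e ^ j
      half b = subst (λ Y → Y * (2 ^ m) ^ j ≤ P′ * e ^ j)
        (count-cong S′ _ λ ψ ψ~ → cong (λ b′ → 𝟙 (greedy b′ j a ψ)) (sym (AgreeOff-≔ b (∉-─ a∈S u) ψ~)))
        (greedy-count e 2^m≡1+e b j a S′ _ (Unique-─ a∈S u) (FreeBeyond-here free a∈S))

∑< : ℕ → (ℕ → ℕ) → ℕ
∑< zero    f = 0
∑< (suc n) f = ∑< n f + f n

syntax ∑< n (λ i → f) = ∑[ i < n ] f

term≤∑ : ∀ {n} f {i} → i < n → f i ≤ ∑< n f
term≤∑ {suc n} f {i} i<1+n with m≤n⇒m<n∨m≡n (s≤s⁻¹ i<1+n)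
... | inj₁ i<n  = ≤-trans (term≤∑ f i<n) (m≤m+n (∑< n f) (f n))
... | inj₂ refl = m≤n+m (f i) (∑< n f)

∑-cong : ∀ n {f g} → (∀ i → f i ≡ g i) → ∑< n f ≡ ∑< n g
∑-cong zero    f≡g = refl
∑-cong (suc n) f≡g = cong₂ _+_ (∑-cong n f≡g) (f≡g n)

∑-mono-≤ : ∀ n {f g} → (∀ i → i < n → f i ≤ g i) → ∑< n f ≤ ∑< n g
∑-mono-≤ zero    f≤g = z≤n
∑-mono-≤ (suc n) f≤g = +-mono-≤ (∑-mono-≤ n (λ i i<n → f≤g i (m<n⇒m<1+n i<n))) (f≤g n ≤-refl)

∑-*ʳ : ∀ n f D → ∑< n f * D ≡ ∑[ i < n ] (f i * D)
∑-*ʳ zero    f D = refl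
∑-*ʳ (suc n) f D = trans (*-distribʳ-+ D (∑< n f) (f n)) (cong (_+ f n * D) (∑-*ʳ n f D))

∑-const : ∀ n W → ∑[ i < n ] W ≡ n * W
∑-const zero    W = refl
∑-const (suc n) W = trans (cong (_+ W) (∑-const n W)) (+-comm (n * W) W)

2*∑<+n≡n*n : ∀ n → 2 * ∑[ i < n ] i + n ≡ n * n
2*∑<+n≡n*n zero    = refl
2*∑<+n≡n*n (suc n) = begin
  2 * (∑[ i < n ] i + n) + suc n   ≡⟨ regroup (∑[ i < n ] i) n ⟩
  (2 * ∑[ i < n ] i + n) + 2 * n + 1 ≡⟨ cong (λ x → x + 2 * n + 1) (2*∑<+n≡n*n n) ⟩
  n * n + 2 * n + 1                ≡⟨ square n ⟩
  suc n * suc n                    ∎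
  where
  open ≡-Reasoning
  regroup : ∀ T n → 2 * (T + n) + suc n ≡ (2 * T + n) + 2 * n + 1
  regroup = solve-∀
  square : ∀ n → n * n + 2 * n + 1 ≡ suc n * suc n
  square = solve-∀

count-∑ : ∀ S n (F : ℕ → Colouring → ℕ) χ → count S (λ ψ → ∑[ i < n ] F i ψ) χ ≡ ∑[ i < n ] count S (F i) χ
count-∑ S zero    F χ = count-0 S χ
count-∑ S (suc n) F χ =
  trans (count-+ S (λ ψ → ∑[ i < n ] F i ψ) (F n) χ) (cong (_+ count S (F n) χ) (count-∑ S n F χ))

positions : ℕ → List ℕ
positions N = applyDownFrom suc N

positions-unique : ∀ N → Unique (positions N)
positions-unique N = applyDownFrom⁺₁ suc N (λ j<i _ → >⇒≢ j<i ∘ suc-injective)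

∈-positions : ∀ {N x} → 1 ≤ x → x ≤ N → x ∈ positions N
∈-positions {x = suc i} _ 1+i≤N = ∈-applyDownFrom⁺ suc 1+i≤N

module UnionBound (m N k : ℕ) where

  -- The pair i < s < N stands for the progression starting at 1 + i with low-difference s - i.
  badness : Colouring → ℕ
  badness ψ = ∑[ s < N ] ∑[ i < s ] 𝟙 (Greedy.monochromaticFrom m N (s ∸ i) k (suc i) ψ)

  badness-count : ∀ e → 2 ^ m ≡ suc e → ∀ χ →
    count (positions N) badness χ * (2 ^ m) ^ k ≤ ∑[ s < N ] s * (2 ^ N * e ^ k)
  badness-count e 2^m≡1+e χ = begin
    count (positions N) badness χ * D
      ≡⟨ cong (_* D) (trans (count-∑ (positions N) N _ χ)
                            (∑-cong N λ s → count-∑ (positions N) s _ χ)) ⟩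
    ∑[ s < N ] ∑[ i < s ] Y s i * D
      ≡⟨ trans (∑-*ʳ N _ D) (∑-cong N λ s → ∑-*ʳ s (Y s) D) ⟩
    ∑[ s < N ] ∑[ i < s ] (Y s i * D)
      ≤⟨ ∑-mono-≤ N (λ s s<N → ∑-mono-≤ s (λ i i<s → Y-bound s i s<N i<s)) ⟩
    ∑[ s < N ] ∑[ i < s ] W
      ≡⟨ ∑-cong N (λ s → ∑-const s W) ⟩
    ∑[ s < N ] (s * W)
      ≡⟨ ∑-*ʳ N (λ s → s) W ⟨
    ∑[ s < N ] s * W ∎
    where
    open ≤-Reasoning
    D = (2 ^ m) ^ k
    W = 2 ^ N * e ^ k
    Y : ℕ → ℕ → ℕ
    Y s i = count (positions N) (𝟙 ∘ Greedy.monochromaticFrom m N (s ∸ i) k (suc i)) χ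
    Y-bound : ∀ s i → s < N → i < s → Y s i * D ≤ W
    Y-bound s i s<N i<s = subst (λ L → Y s i * D ≤ 2 ^ L * e ^ k) (length-applyDownFrom suc N)
      (Greedy.Counting.monochromaticFrom-count m N (s ∸ i) (m<n⇒0<n∸m i<s) e 2^m≡1+e
        k (suc i) (positions N) χ (positions-unique N) (∈-positions (s≤s z≤n) (<-≤-trans i<s (<⇒≤ s<N)))
        (λ t _ inN → ∈-positions (s≤s z≤n) inN))

  forces⇒badness>0 : 1 ≤ k → Forces m (suc k) N → ∀ ψ → 1 ≤ badness ψ
  forces⇒badness>0 k≥1 forces ψ with forces ψ
  ... | x , _ , (d , d≥1 , steps) , inRange , mono with steps 0 (s≤s k≥1)
  ... | t , t≥1 , _ , x₁≡ = begin
    1                                                           ≡⟨ cong 𝟙 found ⟨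
    𝟙 (Greedy.monochromaticFrom m N (s ∸ i) k (suc i) ψ)        ≤⟨ term≤∑ _ i<s ⟩
    ∑[ i′ < s ] 𝟙 (Greedy.monochromaticFrom m N (s ∸ i′) k (suc i′) ψ) ≤⟨ term≤∑ _ s<N ⟩
    badness ψ                                                   ∎
    where
    open ≤-Reasoning
    a = x 0
    i = a ∸ 1
    s = i + d
    1+i≡a : suc i ≡ a
    1+i≡a = m+[n∸m]≡n (proj₁ (inRange 0 (s≤s z≤n)))
    i<s : i < s
    i<s = m<m+n i d≥1
    s<N : s < N
    s<N = begin-strict
      i + d     <⟨ s≤s ≤-refl ⟩
      suc i + d ≡⟨ cong (_+ d) 1+i≡a ⟩
      a + d     ≤⟨ +-monoʳ-≤ a (subst (_≤ t * d) (*-identityˡ d) (*-monoˡ-≤ d t≥1)) ⟩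
      a + t * d ≡⟨ x₁≡ ⟨
      x 1       ≤⟨ proj₂ (inRange 1 (s≤s k≥1)) ⟩
      N         ∎
    chain : Greedy.Chain m N d (ψ a) k a ψ
    chain = x , refl , λ j j<k → let u , u≥1 , u≤m , x≡ = steps j (s≤s j<k) in
      u , u≥1 , u≤m , x≡ , proj₂ (inRange (suc j) (s≤s j<k)) ,
      trans (mono (suc j) (s≤s j<k)) (sym (mono 0 (s≤s z≤n)))
    found : Greedy.monochromaticFrom m N (s ∸ i) k (suc i) ψ ≡ true
    found = subst₂ (λ d′ a′ → Greedy.monochromaticFrom m N d′ k a′ ψ ≡ true)
              (sym (m+n∸m≡n i d)) (sym 1+i≡a) (Greedy.greedy-complete m N d (ψ a) k a ψ chain)

  forces⇒power-bound : 1 ≤ k → Forces m (suc k) N → ∀ e → 2 ^ m ≡ suc e →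
    (2 ^ m) ^ k ≤ ∑[ s < N ] s * e ^ k
  forces⇒power-bound k≥1 forces e 2^m≡1+e = *-cancelˡ-≤ (2 ^ N) {{m^n≢0 2 N}} (begin
    2 ^ N * (2 ^ m) ^ k                          ≤⟨ *-monoˡ-≤ ((2 ^ m) ^ k) 2^N≤badness-count ⟩
    count (positions N) badness χ₀ * (2 ^ m) ^ k ≤⟨ badness-count e 2^m≡1+e χ₀ ⟩
    ∑[ s < N ] s * (2 ^ N * e ^ k)               ≡⟨ *-left-comm (∑[ s < N ] s) (2 ^ N) (e ^ k) ⟩
    2 ^ N * (∑[ s < N ] s * e ^ k)               ∎)
    where
    open ≤-Reasoning
    χ₀ : Colouring
    χ₀ _ = false
    2^N≤badness-count : 2 ^ N ≤ count (positions N) badness χ₀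
    2^N≤badness-count = ≮⇒≥ λ count< →
      let ψ , badness≡0 = count<⇒zero (positions N) badness χ₀
                            (subst (λ L → count (positions N) badness χ₀ < 2 ^ L)
                                   (sym (length-applyDownFrom suc N)) count<)
      in 1+n≰n (subst (1 ≤_) badness≡0 (forces⇒badness>0 k≥1 forces ψ))

forces⇒1≤N : ∀ {m k N} → 1 ≤ k → Forces m k N → 1 ≤ N
forces⇒1≤N k≥1 forces with forces (λ _ → false)
... | _ , _ , _ , inRange , _ = let 1≤x₀ , x₀≤N = inRange 0 k≥1 in ≤-trans 1≤x₀ x₀≤N

mainTheorem1 : (m k : ℕ) → 1 ≤ m → 2 ≤ k →
    (N : ℕ) → Forces m k N →
      2 ^ (m * k) < (N * N) * ((2 ^ m ∸ 1) ^ k)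
mainTheorem1 m (suc k) m≥1 (s≤s k≥1) N forces = begin-strict
  2 ^ (m * suc k)                   ≡⟨ ^-*-assoc 2 m (suc k) ⟨
  2 ^ m * (2 ^ m) ^ k               ≤⟨ *-monoʳ-≤ (2 ^ m) (UnionBound.forces⇒power-bound m N k k≥1 forces e 2^m≡1+e) ⟩
  2 ^ m * (T * e ^ k)               ≤⟨ *-monoˡ-≤ (T * e ^ k) 2^m≤2*e ⟩
  2 * e * (T * e ^ k)               ≡⟨ regroup e T (e ^ k) ⟩
  2 * T * e ^ suc k                 <⟨ m<m+n (2 * T * e ^ suc k) (*-mono-≤ (forces⇒1≤N (s≤s z≤n) forces) e^1+k>0) ⟩
  2 * T * e ^ suc k + N * e ^ suc k ≡⟨ *-distribʳ-+ (e ^ suc k) (2 * T) N ⟨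
  (2 * T + N) * e ^ suc k           ≡⟨ cong (_* e ^ suc k) (2*∑<+n≡n*n N) ⟩
  N * N * e ^ suc k                 ∎
  where
  open ≤-Reasoning
  e = 2 ^ m ∸ 1
  T = ∑[ s < N ] s
  2^m≡1+e : 2 ^ m ≡ suc e
  2^m≡1+e = sym (m+[n∸m]≡n (m^n>0 2 m))
  e≥1 : 1 ≤ e
  e≥1 = s≤s⁻¹ (subst (2 ≤_) 2^m≡1+e (^-monoʳ-≤ 2 m≥1))
  2^m≤2*e : 2 ^ m ≤ 2 * e
  2^m≤2*e = subst₂ _≤_ (sym 2^m≡1+e) (cong (e +_) (sym (+-identityʳ e))) (+-monoˡ-≤ e e≥1)
  e^1+k>0 : 1 ≤ e ^ suc k
  e^1+k>0 = m^n>0 e {{>-nonZero e≥1}} (suc k)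
  regroup : ∀ e T E → 2 * e * (T * E) ≡ 2 * T * (e * E)
  regroup = solve-∀
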